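{- Let $s$ and $t$ be trees on the same node set $V$ with the same root. Then $t\preceq s$ if and only if $t\vdash^* s$.
   Context: A tree is $t=(V_t,\mathrm{root}_t,\mathrm{parent}_t)$ with $V_t$ a finite set of nodes, $\mathrm{root}_t\in V_t$, and $\mathrm{parent}_t:V_t\setminus\{\mathrm{root}_t\}\to V_t$ such that iterating $\mathrm{parent}_t$ from any node reaches the root. $x\preceq_t y$ means $x=\mathrm{parent}_t^k(y)$ for some $k\ge0$ ($x$ is an ancestor of $y$). For trees $t,s$ on the same node set $V$ with the same root, $t\preceq s$ means: for all $x,y\in V$, $x\preceq_t y$ implies $x\preceq_s y$. For a tree $t$ and distinct siblings $x\ne y$ of $t$ (nodes with the same parent), $\mathrm{push}(t,x,y)$ is the tree with the same nodes and root in which the parent of $x$ is $y$ and all other parents are as in $t$. Write $t\vdash t'$ if $t'=\mathrm{push}(t,x,y)$ for some such $x,y$, and $\vdash^*$ for the reflexive-transitive closure of $\vdash$. -}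

module Defs where

open import Data.Nat using (ℕ; zero; suc)
open import Data.Fin using (Fin)
open import Data.Product using (∃; _×_)
open import Relation.Binary.PropositionalEquality using (_≡_; _≢_)

iter : ∀ {n} → (Fin n → Fin n) → ℕ → Fin n → Fin n
iter f zero    x = x
iter f (suc k) x = f (iter f k x)

-- A tree on the finite node set V = Fin n with root r.
-- The parent map is partial (undefined at the root); we represent it as a
-- total map with the fixed convention parent r = r.
record Tree (n : ℕ) (r : Fin n) : Set where
  field
    parent      : Fin n → Fin n
    parent-root : parent r ≡ r
    reaches     : ∀ x → ∃ λ k → iter parent k x ≡ r
open Tree public

_⊑[_]_ : ∀ {n r} → Fin n → Tree n r → Fin n → Set
x ⊑[ t ] y = ∃ λ k → iter (parent t) k y ≡ x

_≼_ : ∀ {n r} → Tree n r → Tree n r → Set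
t ≼ s = ∀ x y → x ⊑[ t ] y → x ⊑[ s ] y

DistinctSiblings : ∀ {n r} → Tree n r → Fin n → Fin n → Set
DistinctSiblings {r = r} t x y =
  x ≢ y × x ≢ r × y ≢ r × parent t x ≡ parent t y

IsPush : ∀ {n r} → Tree n r → Fin n → Fin n → Tree n r → Set
IsPush t x y t' = parent t' x ≡ y × (∀ z → z ≢ x → parent t' z ≡ parent t z)

_⊢_ : ∀ {n r} → Tree n r → Tree n r → Set
t ⊢ t' = ∃ λ x → ∃ λ y → DistinctSiblings t x y × IsPush t x y t'

-- reflexive-transitive closure of ⊢, with trees identified when they have
-- the same parent function (a tree is determined by nodes, root, parent)
data _⊢*_ {n : ℕ} {r : Fin n} : Tree n r → Tree n r → Set where
  done : ∀ {t s} → (∀ z → parent t z ≡ parent s z) → t ⊢* s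
  step : ∀ {t u s} → t ⊢ u → u ⊢* s → t ⊢* s

module Submission where

-- (⇐) A push keeps every old parent above its child (the pushed node x gets
-- the new parent y, whose parent is the old parent of x), and a relation
-- "every t-parent is a u-ancestor" propagates to all t-ancestors.  So each
-- push refines ≼, and ≼ is transitive.
--
-- (⇒) Measure a tree by its size, the number of ancestor pairs; it is
-- monotone in ≼.  If t ≼ s but t and s have different parent maps, we find
-- t-siblings x ≠ y with y an s-ancestor of x (walking up the s-path from a
-- node whose parents disagree).  Pushing x below y gives u with
-- t ⊢ u ≼ s and size t < size u ≤ size s, so induction on
-- size s ∸ size t finishes.

open import Defs
open import Data.Nat using (ℕ; zero; suc; _+_; _*_; _≤_; _<_; z≤n; s≤s; s≤s⁻¹)
open import Data.Nat.Properties
  using (≤-refl; <-≤-trans; ≤-<-trans; <-irrefl; <⇒≤; ≰⇒>; _≤?_; m≤n⇒m≤1+n;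
         m≤m*n; m≤m+n; m≤n⇒∃[o]m+o≡n; +-comm; +-suc; +-monoʳ-≤; anyUpTo?;
         module ≤-Reasoning)
open import Data.Fin using (Fin; _≟_)
open import Data.Fin.Properties using (all?; ¬∀⟶∃¬)
open import Data.Product using (_×_; _,_; ∃; proj₁; proj₂)
open import Data.List using (List; []; _∷_; allFin; cartesianProduct)
open import Data.List.Relation.Unary.Any using (here; there)
open import Data.List.Membership.Propositional using (_∈_)
open import Data.List.Membership.Propositional.Properties
  using (∈-allFin; ∈-cartesianProduct⁺)
open import Relation.Nullary using (¬_; Dec; yes; no; contradiction)
open import Level using (0ℓ)
open import Relation.Unary using (Pred; Decidable)
open import Relation.Binary.PropositionalEquality

Reach : ∀ {n} → (Fin n → Fin n) → Fin n → Fin n → Set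
Reach f a z = ∃ λ k → iter f k z ≡ a

iter-sucʳ : ∀ {n} (f : Fin n → Fin n) k x → iter f (suc k) x ≡ iter f k (f x)
iter-sucʳ f zero    x = refl
iter-sucʳ f (suc k) x = cong f (iter-sucʳ f k x)

iter-+ : ∀ {n} (f : Fin n → Fin n) j k x → iter f (j + k) x ≡ iter f j (iter f k x)
iter-+ f zero    k x = refl
iter-+ f (suc j) k x = cong f (iter-+ f j k x)

Reach-trans : ∀ {n} (f : Fin n → Fin n) {a b c} → Reach f a b → Reach f b c → Reach f a c
Reach-trans f {c = c} (j , b↦a) (k , c↦b) =
  j + k , trans (iter-+ f j k c) (trans (cong (iter f j) c↦b) b↦a)

Reach-mono : ∀ {n} (f g : Fin n → Fin n) → (∀ z → Reach g (f z) z) →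
             ∀ {a z} → Reach f a z → Reach g a z
Reach-mono f g parents {a} (k , e) = along k _ e
  where
  along : ∀ k z → iter f k z ≡ a → Reach g a z
  along zero    z z≡a = 0 , z≡a
  along (suc k) z e   =
    Reach-trans g (along k (f z) (trans (sym (iter-sucʳ f k z)) e)) (parents z)

≼-by-parents : ∀ {n r} (t u : Tree n r) → (∀ z → parent t z ⊑[ u ] z) → t ≼ u
≼-by-parents t u parents a z = Reach-mono (parent t) (parent u) parents

≼-trans : ∀ {n r} {t u s : Tree n r} → t ≼ u → u ≼ s → t ≼ s
≼-trans t≼u u≼s a z a⊑z = u≼s a z (t≼u a z a⊑z)

module _ {n : ℕ} {r : Fin n} (t : Tree n r) where
  private
    p : Fin n → Fin n
    p = parent t

  iter-root : ∀ k → iter p k r ≡ r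
  iter-root zero    = refl
  iter-root (suc k) = trans (cong p (iter-root k)) (parent-root t)

  iter-beyond : ∀ {K j z} → iter p K z ≡ r → K ≤ j → iter p j z ≡ r
  iter-beyond {K} {j} {z} e K≤j with m≤n⇒∃[o]m+o≡n K≤j
  ... | i , refl = begin
    iter p (K + i) z   ≡⟨ cong (λ m → iter p m z) (+-comm K i) ⟩
    iter p (i + K) z   ≡⟨ iter-+ p i K z ⟩
    iter p i (iter p K z) ≡⟨ cong (iter p i) e ⟩
    iter p i r         ≡⟨ iter-root i ⟩
    r                  ∎
    where open ≡-Reasoning

  -- The only periodic point of the parent map is the root: the period can be
  -- repeated past the number of steps the point needs to reach the root.
  periodic⇒root : ∀ d {a} → iter p (suc d) a ≡ a → a ≡ r
  periodic⇒root d {a} periodic =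
    trans (sym (repeat K)) (iter-beyond (proj₂ (reaches t a)) (m≤m*n K (suc d)))
    where
    K : ℕ
    K = proj₁ (reaches t a)
    repeat : ∀ m → iter p (m * suc d) a ≡ a
    repeat zero    = refl
    repeat (suc m) =
      trans (iter-+ p (suc d) (m * suc d) a) (trans (cong (iter p (suc d)) (repeat m)) periodic)

  ⊑-antisym : ∀ {a b} → a ⊑[ t ] b → b ⊑[ t ] a → a ≡ b
  ⊑-antisym (zero , b≡a) _ = sym b≡a
  ⊑-antisym {a} {b} (suc j , b↦a) (k , a↦b) = trans a≡r (sym b≡r)
    where
    a≡r : a ≡ r
    a≡r = periodic⇒root (j + k)
      (trans (iter-+ p (suc j) k a) (trans (cong (iter p (suc j)) a↦b) b↦a))
    b≡r : b ≡ r
    b≡r = trans (sym a↦b) (trans (cong (iter p k) a≡r) (iter-root k))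

  -- Ancestry is decidable: it suffices to search the steps up to the time
  -- K at which b reaches the root, since later steps all give the root.
  _⊑?_ : ∀ a b → Dec (a ⊑[ t ] b)
  a ⊑? b = within-horizon (anyUpTo? (λ k → iter p k b ≟ a) (suc K))
    where
    K : ℕ
    K = proj₁ (reaches t b)
    b↦r : iter p K b ≡ r
    b↦r = proj₂ (reaches t b)
    truncate : ∀ j → iter p j b ≡ a → ∃ λ k → k < suc K × iter p k b ≡ a
    truncate j e with j ≤? K
    ... | yes j≤K = j , s≤s j≤K , e
    ... | no j≰K  = K , ≤-refl , trans b↦r (trans (sym (iter-beyond b↦r (<⇒≤ (≰⇒> j≰K)))) e)
    within-horizon : Dec (∃ λ k → k < suc K × iter p k b ≡ a) → Dec (a ⊑[ t ] b)
    within-horizon (yes (k , _ , e)) = yes (k , e)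
    within-horizon (no none)         = no λ (j , e) → none (truncate j e)

  -- Distinct siblings are incomparable: if y were above its sibling x it
  -- would be above its own parent, making y periodic, hence the root.
  siblings-incomparable : ∀ {x y} → DistinctSiblings t x y → ¬ (y ⊑[ t ] x)
  siblings-incomparable (x≢y , _ , _ , _) (zero , x≡y) = x≢y x≡y
  siblings-incomparable {x} {y} (_ , _ , y≢r , px≡py) (suc j , x↦y) =
    y≢r (periodic⇒root j (begin
      iter p (suc j) y   ≡⟨ iter-sucʳ p j y ⟩
      iter p j (p y)     ≡⟨ cong (iter p j) (sym px≡py) ⟩
      iter p j (p x)     ≡⟨ sym (iter-sucʳ p j x) ⟩
      iter p (suc j) x   ≡⟨ x↦y ⟩
      y                  ∎))
    where open ≡-Reasoning

  child-on-path : ∀ {x a} → x ≢ r → a ⊑[ t ] p x → ∃ λ c → c ≢ r × p c ≡ a × c ⊑[ t ] x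
  child-on-path {x} {a} x≢r (j , px↦a) = go j (trans (iter-sucʳ p j x) px↦a)
    where
    go : ∀ j → iter p (suc j) x ≡ a → ∃ λ c → c ≢ r × p c ≡ a × c ⊑[ t ] x
    go j x↦a with iter p j x ≟ r
    ... | no c≢r = iter p j x , c≢r , x↦a , j , refl
    go zero    x↦a | yes x≡r = contradiction x≡r x≢r
    go (suc j) x↦a | yes c≡r =
      go j (trans c≡r (trans (sym (parent-root t)) (trans (cong p (sym c≡r)) x↦a)))

differing-parents⇒non-root : ∀ {n r} (t s : Tree n r) {x} → parent t x ≢ parent s x → x ≢ r
differing-parents⇒non-root t s differ refl = differ (trans (parent-root t) (sym (parent-root s)))

parent-above : ∀ {n r} {t s : Tree n r} → t ≼ s → ∀ {x} → x ≢ r → parent t x ⊑[ s ] parent s x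
parent-above {t = t} {s} t≼s {x} x≢r with t≼s (parent t x) x (1 , refl)
... | zero  , x≡ptx = contradiction (periodic⇒root t 0 (sym x≡ptx)) x≢r
... | suc k , e     = k , trans (sym (iter-sucʳ (parent s) k x)) e

module _ {A : Set} where

  count : {P : Pred A 0ℓ} → Decidable P → List A → ℕ
  count P? []       = 0
  count P? (a ∷ as) with P? a
  ... | yes _ = suc (count P? as)
  ... | no  _ = count P? as

  module _ {P Q : Pred A 0ℓ} (P? : Decidable P) (Q? : Decidable Q)
           (P⇒Q : ∀ {a} → P a → Q a) where

    count-mono : ∀ as → count P? as ≤ count Q? as
    count-mono []       = z≤n
    count-mono (a ∷ as) with P? a | Q? a
    ... | yes _ | yes _  = s≤s (count-mono as)
    ... | yes p | no ¬q  = contradiction (P⇒Q p) ¬q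
    ... | no _  | yes _  = m≤n⇒m≤1+n (count-mono as)
    ... | no _  | no _   = count-mono as

    count-strict : ∀ {a} as → a ∈ as → Q a → ¬ P a → count P? as < count Q? as
    count-strict (b ∷ as) (here refl) q ¬p with P? b | Q? b
    ... | yes p | _     = contradiction p ¬p
    ... | no _  | yes _ = s≤s (count-mono as)
    ... | no _  | no ¬q = contradiction q ¬q
    count-strict (b ∷ as) (there a∈as) q ¬p with P? b | Q? b
    ... | yes _ | yes _ = s≤s (count-strict as a∈as q ¬p)
    ... | yes p | no ¬q = contradiction (P⇒Q p) ¬q
    ... | no _  | yes _ = m≤n⇒m≤1+n (count-strict as a∈as q ¬p)
    ... | no _  | no _  = count-strict as a∈as q ¬p

depth : ∀ {n r} → Tree n r → Fin n → ℕ
depth {n} t a = count (λ b → _⊑?_ t b a) (allFin n)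

depth-strict : ∀ {n r} (t : Tree n r) {a b} → a ⊑[ t ] b → a ≢ b → depth t a < depth t b
depth-strict {n} t {a} {b} a⊑b a≢b =
  count-strict (λ c → _⊑?_ t c a) (λ c → _⊑?_ t c b)
    (λ c⊑a → Reach-trans (parent t) c⊑a a⊑b) (allFin n) (∈-allFin b)
    (0 , refl) (λ b⊑a → a≢b (⊑-antisym t a⊑b b⊑a))

size : ∀ {n r} → Tree n r → ℕ
size {n} t = count (λ pair → _⊑?_ t (proj₁ pair) (proj₂ pair))
                   (cartesianProduct (allFin n) (allFin n))

size-mono : ∀ {n r} {t u : Tree n r} → t ≼ u → size t ≤ size u
size-mono {n} {t = t} {u} t≼u =
  count-mono (λ pair → _⊑?_ t (proj₁ pair) (proj₂ pair))
             (λ pair → _⊑?_ u (proj₁ pair) (proj₂ pair))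
             (t≼u _ _) (cartesianProduct (allFin n) (allFin n))

size-strict : ∀ {n r} {t u : Tree n r} → t ≼ u → ∀ {a z} → a ⊑[ u ] z → ¬ (a ⊑[ t ] z) →
              size t < size u
size-strict {n} {t = t} {u} t≼u {a} {z} =
  count-strict (λ pair → _⊑?_ t (proj₁ pair) (proj₂ pair))
               (λ pair → _⊑?_ u (proj₁ pair) (proj₂ pair))
               (t≼u _ _) (cartesianProduct (allFin n) (allFin n))
               (∈-cartesianProduct⁺ (∈-allFin a) (∈-allFin z))

-- Any parent map g agreeing with push(t,x,y) keeps every t-parent above
-- its child: the t-parent of x is the g-parent of y = g x.
push-extends : ∀ {n r} (t : Tree n r) {x y} → DistinctSiblings t x y →
               (g : Fin n → Fin n) → g x ≡ y → (∀ z → z ≢ x → g z ≡ parent t z) →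
               ∀ z → Reach g (parent t z) z
push-extends t {x} {y} (x≢y , _ , _ , px≡py) g gx≡y g-elsewhere z with z ≟ x
... | yes refl = 2 , (begin
  g (g x)      ≡⟨ cong g gx≡y ⟩
  g y          ≡⟨ g-elsewhere y (λ y≡x → x≢y (sym y≡x)) ⟩
  parent t y   ≡⟨ sym px≡py ⟩
  parent t x   ∎)
  where open ≡-Reasoning
... | no z≢x = 1 , g-elsewhere z z≢x

⊢⇒≼ : ∀ {n r} {t u : Tree n r} → t ⊢ u → t ≼ u
⊢⇒≼ {t = t} {u} (x , y , siblings , ux≡y , u-elsewhere) =
  ≼-by-parents t u (push-extends t siblings (parent u) ux≡y u-elsewhere)

module Push {n r} (t : Tree n r) {x y} (siblings : DistinctSiblings t x y) where

  pushParent : Fin n → Fin n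
  pushParent z with z ≟ x
  ... | yes _ = y
  ... | no  _ = parent t z

  pushParent-x : pushParent x ≡ y
  pushParent-x with x ≟ x
  ... | yes _   = refl
  ... | no  x≢x = contradiction refl x≢x

  pushParent-elsewhere : ∀ z → z ≢ x → pushParent z ≡ parent t z
  pushParent-elsewhere z z≢x with z ≟ x
  ... | yes z≡x = contradiction z≡x z≢x
  ... | no  _   = refl

  push : Tree n r
  push = record
    { parent      = pushParent
    ; parent-root = trans (pushParent-elsewhere r (λ r≡x → x≢r (sym r≡x))) (parent-root t)
    ; reaches     = λ z → Reach-mono (parent t) pushParent
        (push-extends t siblings pushParent pushParent-x pushParent-elsewhere) (reaches t z)
    }
    where
    x≢r : x ≢ r
    x≢r = proj₁ (proj₂ siblings)

  t⊢push : t ⊢ push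
  t⊢push = x , y , siblings , pushParent-x , pushParent-elsewhere

  push-below : ∀ {s : Tree n r} → t ≼ s → y ⊑[ s ] x → push ≼ s
  push-below {s} t≼s y⊑x = ≼-by-parents push s below
    where
    below : ∀ z → pushParent z ⊑[ s ] z
    below z with z ≟ x
    ... | yes refl = y⊑x
    ... | no  _    = t≼s (parent t z) z (1 , refl)

-- Starting from a node x whose parents differ,
-- let c be the s-child of parent t x on the s-path from x.  Either c is a
-- t-sibling of x, or the parents of c differ too and parent t c lies
-- strictly above parent t x in s; the depth of parent t x then bounds the
-- climb.
pushable-pair : ∀ {n r} {t s : Tree n r} → t ≼ s → ∀ {x₀} → parent t x₀ ≢ parent s x₀ →
                ∃ λ x → ∃ λ y → DistinctSiblings t x y × y ⊑[ s ] x
pushable-pair {r = r} {t} {s} t≼s {x₀} differ₀ =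
  climb (suc (depth s (parent t x₀))) x₀ differ₀ ≤-refl
  where
  climb : ∀ fuel x → parent t x ≢ parent s x → depth s (parent t x) < fuel →
          ∃ λ x → ∃ λ y → DistinctSiblings t x y × y ⊑[ s ] x
  climb (suc fuel) x differ bound =
    compare (child-on-path s x≢r (parent-above {t = t} {s} t≼s x≢r))
    where
    x≢r : x ≢ r
    x≢r = differing-parents⇒non-root t s differ
    compare : (∃ λ c → c ≢ r × parent s c ≡ parent t x × c ⊑[ s ] x) →
              ∃ λ x → ∃ λ y → DistinctSiblings t x y × y ⊑[ s ] x
    compare (c , c≢r , ps-c≡pt-x , c⊑x) with parent t c ≟ parent t x
    ... | yes same  = x , c , (x≢c , x≢r , c≢r , sym same) , c⊑x
      where
      x≢c : x ≢ c
      x≢c refl = differ (sym ps-c≡pt-x)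
    ... | no  other = climb fuel c (λ e → other (trans e ps-c≡pt-x)) (<-≤-trans higher (s≤s⁻¹ bound))
      where
      higher : depth s (parent t c) < depth s (parent t x)
      higher = depth-strict s
        (subst (parent t c ⊑[ s ]_) ps-c≡pt-x (parent-above {t = t} {s} t≼s c≢r)) other

-- Forward direction, by induction on a bound for size s ∸ size t: while
-- t ≠ s, push a pushable pair; the size grows strictly but stays ≤ size s.
≼⇒⊢*-within : ∀ {n r} (s : Tree n r) m (t : Tree n r) → t ≼ s → size s ≤ m + size t → t ⊢* s
≼⇒⊢*-within {n} s m t t≼s bound with all? (λ z → parent t z ≟ parent s z)
... | yes same = done same
... | no ¬same with ¬∀⟶∃¬ n _ (λ z → parent t z ≟ parent s z) ¬same
... | x₀ , differ with pushable-pair {t = t} {s} t≼s differ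
... | x , y , siblings , y⊑x = step t⊢push (continue m bound)
  where
  open Push t siblings
  push≼s : push ≼ s
  push≼s = push-below {s = s} t≼s y⊑x
  grows : size t < size push
  grows = size-strict {t = t} {push} (⊢⇒≼ {t = t} {push} t⊢push)
                      (1 , pushParent-x) (siblings-incomparable t siblings)
  continue : ∀ m → size s ≤ m + size t → push ⊢* s
  continue zero    bound =
    contradiction (<-≤-trans (≤-<-trans bound grows) (size-mono {t = push} {s} push≼s)) (<-irrefl refl)
  continue (suc m) bound = ≼⇒⊢*-within s m push push≼s (begin
    size s                ≤⟨ bound ⟩
    suc (m + size t)      ≡⟨ sym (+-suc m (size t)) ⟩
    m + suc (size t)      ≤⟨ +-monoʳ-≤ m grows ⟩
    m + size push         ∎)
    where open ≤-Reasoning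

≼⇒⊢* : ∀ {n r} {t s : Tree n r} → t ≼ s → t ⊢* s
≼⇒⊢* {t = t} {s} t≼s = ≼⇒⊢*-within s (size s) t t≼s (m≤m+n (size s) (size t))

⊢*⇒≼ : ∀ {n r} {t s : Tree n r} → t ⊢* s → t ≼ s
⊢*⇒≼ {t = t} {s} (done same) = ≼-by-parents t s (λ z → 1 , sym (same z))
⊢*⇒≼ {t = t} {s} (step {u = u} t⊢u u⊢*s) =
  ≼-trans {t = t} {u} {s} (⊢⇒≼ {t = t} {u} t⊢u) (⊢*⇒≼ u⊢*s)

proposition1 : (n : ℕ) (r : Fin n) (s t : Tree n r) →
    ((t ≼ s → t ⊢* s) × (t ⊢* s → t ≼ s))
proposition1 n r s t = ≼⇒⊢* , ⊢*⇒≼
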